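{- For every finite semigroup $S$ there exists a sequence of classes of $S$-labelled trees $\mathcal{H}_0\subseteq\mathcal{H}_1\subseteq\cdots\subseteq\mathcal{H}_{3|S|}$ such that: $\mathcal{H}_0$ consists only of one tree with one node, while $\mathcal{H}_{3|S|}$ is the class of all $S$-labelled trees; and for every $i\in[3|S|]$, every tree $(T,\rho)\in\mathcal{H}_i$ has a factorization $\mathcal{P}$ such that all factors of $\mathcal{P}$ (with the restricted labelling) belong to $\mathcal{H}_{i-1}$ and $(T/\mathcal{P},\rho/\mathcal{P})$ is either splendid or shallow.
   Context: An $S$-labelled tree is a rooted tree $T$ with a map $\rho\colon E(T)\to S$. A subset $A\subseteq S$ is forward Ramsey if $e\cdot f=e$ for all $e,f\in A$. An $S$-labelled tree is splendid if $\{\rho(e):e\in E(T)\}$ is forward Ramsey, and shallow if every root-to-node path has at most $2$ edges. A factorization of a rooted tree $T$ is a partition $\mathcal{P}$ of $V(T)$ into parts each inducing a connected subtree (a factor); factors inherit the restricted labelling and are rooted at their top-most vertex $\mathsf{top}(F)$. The quotient tree $T/\mathcal{P}$ has node set $\{\mathsf{top}(F):F\in\mathcal{P}\}$ with the ancestor relation inherited from $T$. Its labelling $\rho/\mathcal{P}$ assigns to an edge $xy$ of $T/\mathcal{P}$ ($x$ the parent of $y$) the product $\rho(e_1)\cdot\rho(e_2)\cdots\rho(e_m)$, where $e_1,\dots,e_m$ are the consecutive edges of the path from $x$ to $y$ in $T$. -}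

module Defs where

open import Data.Nat using (ℕ; zero; suc; _≤_; _⊔_)
open import Data.Fin using (Fin)
open import Data.Bool using (Bool; true; false)
open import Data.List using (List; []; _∷_; _++_; map)
open import Data.List.Membership.Propositional using (_∈_)
open import Data.Product using (Σ; _×_; _,_; proj₁)
open import Relation.Binary.PropositionalEquality using (_≡_)

-- Finite semigroups.  A finite semigroup with |S| = n is represented (up
-- to isomorphism) by the carrier Fin n with an associative operation.

record FinSemigroup (n : ℕ) : Set where
  field
    _·_   : Fin n → Fin n → Fin n
    assoc : ∀ x y z → ((x · y) · z) ≡ (x · (y · z))

-- Finite rooted trees whose edges carry labels in A.  A node is given by
-- the list of its children, each together with the label of the edge
-- from the node to that child.

data Tree (A : Set) : Set where
  node : List (A × Tree A) → Tree A

leaf : {A : Set} → Tree A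
leaf = node []

mutual
  mapT : {A B : Set} → (A → B) → Tree A → Tree B
  mapT f (node cs) = node (mapC f cs)

  mapC : {A B : Set} → (A → B) → List (A × Tree A) → List (B × Tree B)
  mapC f [] = []
  mapC f ((a , t) ∷ cs) = (f a , mapT f t) ∷ mapC f cs

mutual
  labels : {A : Set} → Tree A → List A
  labels (node cs) = labelsC cs

  labelsC : {A : Set} → List (A × Tree A) → List A
  labelsC [] = []
  labelsC ((a , t) ∷ cs) = a ∷ (labels t ++ labelsC cs)

mutual
  height : {A : Set} → Tree A → ℕ
  height (node cs) = heightC cs

  heightC : {A : Set} → List (A × Tree A) → ℕ
  heightC [] = 0
  heightC ((a , t) ∷ cs) = suc (height t) ⊔ heightC cs

module _ {n : ℕ} (S : FinSemigroup n) where
  open FinSemigroup S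

  ForwardRamsey : List (Fin n) → Set
  ForwardRamsey A = ∀ e f → e ∈ A → f ∈ A → (e · f) ≡ e

  Splendid : Tree (Fin n) → Set
  Splendid T = ForwardRamsey (labels T)

Shallow : {A : Set} → Tree A → Set
Shallow T = height T ≤ 2

-- A partition of V(T) into parts inducing connected subtrees is the same
-- thing as the set of edges of T joining two different parts (each part is
-- a connected component of T minus these edges).  We therefore encode a
-- factorization of T as a copy of T in which every edge carries, besides
-- its label, a Boolean: true = the edge is cut (its endpoints lie in
-- different factors), false = both endpoints lie in the same factor.

Factorization : {A : Set} → Tree A → Set
Factorization {A} T = Σ (Tree (A × Bool)) (λ P → mapT proj₁ P ≡ T)

mutual
  rootFactor : {A : Set} → Tree (A × Bool) → Tree A
  rootFactor (node cs) = node (rootFactorC cs)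

  rootFactorC : {A : Set} → List ((A × Bool) × Tree (A × Bool)) → List (A × Tree A)
  rootFactorC [] = []
  rootFactorC (((a , true) , t) ∷ cs) = rootFactorC cs
  rootFactorC (((a , false) , t) ∷ cs) = (a , rootFactor t) ∷ rootFactorC cs

mutual
  allFactors : {A : Set} → Tree (A × Bool) → List (Tree A)
  allFactors t = rootFactor t ∷ innerFactors t

  innerFactors : {A : Set} → Tree (A × Bool) → List (Tree A)
  innerFactors (node cs) = innerFactorsC cs

  innerFactorsC : {A : Set} → List ((A × Bool) × Tree (A × Bool)) → List (Tree A)
  innerFactorsC [] = []
  innerFactorsC (((a , true) , t) ∷ cs) = allFactors t ++ innerFactorsC cs
  innerFactorsC (((a , false) , t) ∷ cs) = innerFactors t ++ innerFactorsC cs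

factors : {A : Set} {T : Tree A} → Factorization T → List (Tree A)
factors (P , _) = allFactors P

-- the quotient tree T/P with labelling ρ/P: nodes are the tops of the
-- factors, an edge x→y is labelled by ρ(e₁)·…·ρ(eₘ) along the T-path from x to y
module _ {A : Set} (_·_ : A → A → A) where
  mutual
    quotT : Tree (A × Bool) → Tree A
    quotT (node cs) = node (quotC cs)

    quotC : List ((A × Bool) × Tree (A × Bool)) → List (A × Tree A)
    quotC [] = []
    quotC (((a , true) , t) ∷ cs) = (a , quotT t) ∷ quotC cs
    quotC (((a , false) , node ds) ∷ cs) =
      map (λ p → ((a · proj₁ p) , Data.Product.proj₂ p)) (quotC ds) ++ quotC cs

quotient : {n : ℕ} (S : FinSemigroup n) {T : Tree (Fin n)} → Factorization T → Tree (Fin n)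
quotient S (P , _) = quotT (FinSemigroup._·_ S) P

module Submission where

-- Labels are read in the monoid S¹ (S with an identity adjoined).  If every product along
-- a vertical path ("infix") of W lies in a list X ⊆ S¹, then W ∈ H_{3|X|}; this is shown
-- by induction on |X|.  Pick s ∈ X minimal for the J-preorder and call a node low when the
-- product since the previous low node is ≤J s.  At a low node the product from the top is
-- then one of the values of X below s, all J-equivalent to s by minimality.  These values
-- g are removed one at a time: cutting at the topmost low nodes with product g from the top
-- gives a shallow quotient; cutting the factors hanging below them at every such node gives
-- a splendid quotient, as every quotient label u satisfies g·u = g and u ≤J g, hence
-- u ≤L g by stability, so that e·f = e for all labels e, f.  In the resulting factors the
-- value g no longer occurs at low nodes.  When no value is left there are no low nodes,
-- so all infixes avoid the values below s and the induction hypothesis applies.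

open import Defs
open import Data.Nat using (ℕ; suc; _<_; _*_)
open import Data.Fin using (Fin)
open import Data.List.Relation.Unary.All using (All)
open import Data.Product using (Σ; _×_; ∃)
open import Data.Sum using (_⊎_)
open import Relation.Binary.PropositionalEquality using (_≡_)
open import Function.Bundles using (_⇔_)

open import Function.Bundles using (mk⇔)
open import Function using (_∘_)
open import Data.Nat using (zero; _+_; _≤_; z≤n; s≤s)
open import Data.Nat.Properties
  using (+-comm; +-assoc; +-suc; *-suc; *-distribˡ-+; +-identityʳ;
         ≤-refl; ≤-trans; ≤-pred; ≤-reflexive; ⊔-lub; m≤n⇒∃[o]m+o≡n)
open import Data.Fin using (toℕ) renaming (zero to fzero; suc to fsuc)
import Data.Fin.Properties as Fin
open import Data.Maybe using (Maybe; just; nothing)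
open import Data.Maybe.Properties using (just-injective; ≡-dec)
open import Data.Bool using (Bool; true; false; _∨_; if_then_else_) renaming (_≟_ to _≟ᵇ_)
open import Data.List using (List; []; _∷_; map; length; filter; allFin)
open import Data.List.Properties using (length-map; length-tabulate; filter-notAll)
open import Data.List.Relation.Unary.All using ([]; _∷_; lookup; tabulate)
import Data.List.Relation.Unary.All as All
import Data.List.Relation.Unary.All.Properties as AllP
open import Data.List.Relation.Unary.Any using (here; there)
open import Data.List.Membership.Propositional using (_∈_; lose)
open import Data.List.Relation.Binary.Subset.Propositional using (_⊆_)
open import Data.List.Membership.Propositional.Properties
  using (∈-map⁺; ∈-map⁻; ∈-filter⁺; ∈-filter⁻; ∈-allFin)
open import Data.Product using (_,_; proj₁; proj₂; ∃₂)
open import Data.Sum using (inj₁; inj₂)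
open import Data.Unit using (⊤; tt)
open import Data.Empty using (⊥)
open import Relation.Nullary using (Dec; yes; no; ¬_; does; contradiction)
open import Relation.Nullary.Decidable using (¬?; _×-dec_; dec-true; dec-false)
open import Relation.Binary.PropositionalEquality
  using (refl; sym; trans; cong; cong₂; subst; module ≡-Reasoning)

-- In a finite monoid every element has an idempotent positive power.  Finiteness is
-- given by an injective encoding into some Fin k.
module FiniteMonoid
  {A : Set} (_∙_ : A → A → A) (ε : A)
  (assoc : ∀ x y z → (x ∙ y) ∙ z ≡ x ∙ (y ∙ z))
  (identityˡ : ∀ x → ε ∙ x ≡ x) (identityʳ : ∀ x → x ∙ ε ≡ x)
  {k : ℕ} (encode : A → Fin k) (encode-injective : ∀ {x y} → encode x ≡ encode y → x ≡ y)
  where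

  infixr 25 _^_
  _^_ : A → ℕ → A
  x ^ zero = ε
  x ^ suc m = x ∙ (x ^ m)

  ^-+ : ∀ x m l → x ^ (m + l) ≡ (x ^ m) ∙ (x ^ l)
  ^-+ x zero l = sym (identityˡ (x ^ l))
  ^-+ x (suc m) l = trans (cong (x ∙_) (^-+ x m l)) (sym (assoc x (x ^ m) (x ^ l)))

  ^-comm : ∀ x m → x ∙ (x ^ m) ≡ (x ^ m) ∙ x
  ^-comm x m = trans (cong (x ^_) (+-comm 1 m))
                 (trans (^-+ x m 1) (cong ((x ^ m) ∙_) (identityʳ x)))

  periodic : ∀ x a d → x ^ a ≡ x ^ (a + d) → ∀ m c → x ^ (a + (m * d + c)) ≡ x ^ (a + c)
  periodic x a d xᵃ≡xᵃ⁺ᵈ zero c = refl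
  periodic x a d xᵃ≡xᵃ⁺ᵈ (suc m) c = begin
    x ^ (a + (d + m * d + c))   ≡⟨ cong (λ e → x ^ (a + e)) (+-assoc d (m * d) c) ⟩
    x ^ (a + (d + (m * d + c))) ≡⟨ cong (x ^_) (sym (+-assoc a d (m * d + c))) ⟩
    x ^ (a + d + (m * d + c))   ≡⟨ ^-+ x (a + d) (m * d + c) ⟩
    x ^ (a + d) ∙ x ^ (m * d + c) ≡⟨ cong (_∙ x ^ (m * d + c)) (sym xᵃ≡xᵃ⁺ᵈ) ⟩
    x ^ a ∙ x ^ (m * d + c)     ≡⟨ sym (^-+ x a (m * d + c)) ⟩
    x ^ (a + (m * d + c))       ≡⟨ periodic x a d xᵃ≡xᵃ⁺ᵈ m c ⟩
    x ^ (a + c)                 ∎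
    where open ≡-Reasoning

  -- If x^a = x^(a+d) with a, d ≥ 1 then x^(a·d) is idempotent.
  idempotent-from-period : ∀ x a d → x ^ suc a ≡ x ^ (suc a + suc d) →
    ∃ λ m → x ^ suc m ∙ x ^ suc m ≡ x ^ suc m
  idempotent-from-period x a d eq = a + a₁ * d , (begin
    x ^ e ∙ x ^ e                ≡⟨ sym (^-+ x e e) ⟩
    x ^ (e + e)                  ≡⟨ cong (x ^_) e+e ⟩
    x ^ (a₁ + (a₁ * suc d + a₁ * d)) ≡⟨ periodic x a₁ (suc d) eq a₁ (a₁ * d) ⟩
    x ^ e                        ∎)
    where
    open ≡-Reasoning
    a₁ = suc a
    e = a₁ + a₁ * d
    e+e : e + e ≡ a₁ + (a₁ * suc d + a₁ * d)
    e+e = trans (+-assoc a₁ (a₁ * d) e)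
            (cong (a₁ +_) (trans (+-comm (a₁ * d) e) (cong (_+ a₁ * d) (sym (*-suc a₁ d)))))

  idempotent-power : ∀ x → ∃ λ m → x ^ suc m ∙ x ^ suc m ≡ x ^ suc m
  idempotent-power x with Fin.pigeonhole ≤-refl (λ i → encode (x ^ suc (toℕ i)))
  ... | i , j , i<j , same-code with m≤n⇒∃[o]m+o≡n i<j
  ...   | d , i+d≡j = idempotent-from-period x (toℕ i) d (begin
    x ^ suc (toℕ i)             ≡⟨ encode-injective same-code ⟩
    x ^ suc (toℕ j)             ≡⟨ cong (λ e → x ^ suc e) (sym i+d≡j) ⟩
    x ^ suc (suc (toℕ i) + d)   ≡⟨ cong (x ^_) (sym (+-suc (suc (toℕ i)) d)) ⟩
    x ^ (suc (toℕ i) + suc d)   ∎)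
    where open ≡-Reasoning

-- The monoid S¹ = S + {1} (the adjoined identity is `nothing`) and its J- and L-preorders.
module Monoid¹ {n : ℕ} (S : FinSemigroup n) where
  open FinSemigroup S

  S¹ : Set
  S¹ = Maybe (Fin n)

  infixl 7 _⊗_
  _⊗_ : S¹ → S¹ → S¹
  nothing ⊗ v = v
  just u ⊗ nothing = just u
  just u ⊗ just v = just (u · v)

  ⊗-identityʳ : ∀ u → u ⊗ nothing ≡ u
  ⊗-identityʳ nothing = refl
  ⊗-identityʳ (just u) = refl

  ⊗-assoc : ∀ u v w → (u ⊗ v) ⊗ w ≡ u ⊗ (v ⊗ w)
  ⊗-assoc nothing v w = refl
  ⊗-assoc (just u) nothing w = refl
  ⊗-assoc (just u) (just v) nothing = refl
  ⊗-assoc (just u) (just v) (just w) = cong just (assoc u v w)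

  encode : S¹ → Fin (suc n)
  encode nothing = fzero
  encode (just u) = fsuc u

  encode-injective : ∀ {u v} → encode u ≡ encode v → u ≡ v
  encode-injective {nothing} {nothing} _ = refl
  encode-injective {just u} {just v} eq = cong just (Fin.suc-injective eq)

  open FiniteMonoid _⊗_ nothing ⊗-assoc (λ _ → refl) ⊗-identityʳ encode encode-injective
    public using (_^_; ^-comm; idempotent-power)

  infix 4 _≤J_ _≤L_ _≤J?_ _≟_

  _≤J_ : S¹ → S¹ → Set
  u ≤J v = ∃₂ λ p q → u ≡ (p ⊗ v) ⊗ q

  _≤L_ : S¹ → S¹ → Set
  u ≤L v = ∃ λ t → u ≡ t ⊗ v

  ≤J-refl : ∀ u → u ≤J u
  ≤J-refl u = nothing , nothing , sym (⊗-identityʳ u)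

  ≤J-trans : ∀ {u v w} → u ≤J v → v ≤J w → u ≤J w
  ≤J-trans {u} {v} {w} (p , q , u≡pvq) (p' , q' , v≡p'wq') = p ⊗ p' , q' ⊗ q , (begin
    u                         ≡⟨ u≡pvq ⟩
    (p ⊗ v) ⊗ q               ≡⟨ cong (λ z → (p ⊗ z) ⊗ q) v≡p'wq' ⟩
    (p ⊗ ((p' ⊗ w) ⊗ q')) ⊗ q ≡⟨ cong (_⊗ q) (sym (⊗-assoc p (p' ⊗ w) q')) ⟩
    ((p ⊗ (p' ⊗ w)) ⊗ q') ⊗ q ≡⟨ ⊗-assoc (p ⊗ (p' ⊗ w)) q' q ⟩
    (p ⊗ (p' ⊗ w)) ⊗ (q' ⊗ q) ≡⟨ cong (_⊗ (q' ⊗ q)) (sym (⊗-assoc p p' w)) ⟩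
    ((p ⊗ p') ⊗ w) ⊗ (q' ⊗ q) ∎)
    where open ≡-Reasoning

  ≤L-refl : ∀ u → u ≤L u
  ≤L-refl u = nothing , refl

  ≤L-one : ∀ u → u ≤L nothing
  ≤L-one u = u , sym (⊗-identityʳ u)

  ≤L-⊗ʳ : ∀ {u v} w → u ≤L v → (u ⊗ w) ≤L (v ⊗ w)
  ≤L-⊗ʳ {v = v} w (t , u≡tv) = t , trans (cong (_⊗ w) u≡tv) (⊗-assoc t v w)

  ≤L⇒≤J : ∀ {u v} → u ≤L v → u ≤J v
  ≤L⇒≤J (t , u≡tv) = t , nothing , trans u≡tv (sym (⊗-identityʳ _))

  _≟_ : (u v : S¹) → Dec (u ≡ v)
  _≟_ = ≡-dec Fin._≟_

  ∃? : {P : S¹ → Set} → (∀ u → Dec (P u)) → Dec (∃ P)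
  ∃? P? with P? nothing | Fin.any? (λ i → P? (just i))
  ... | yes p | _ = yes (nothing , p)
  ... | no _ | yes (i , p) = yes (just i , p)
  ... | no ¬p | no ¬q = no λ { (nothing , p) → ¬p p ; (just i , p) → ¬q (i , p) }

  _≤J?_ : (u v : S¹) → Dec (u ≤J v)
  u ≤J? v = ∃? (λ p → ∃? (λ q → u ≟ ((p ⊗ v) ⊗ q)))

  -- Writing u = (p·g)·q and y = p·g,
  -- we get u = yᵐ·u·qᵐ for all m; an idempotent power e of y then satisfies e·u = u,
  -- whence u = yᵏ·y·u = yᵏ·p·g.
  stability : ∀ {u g} → u ≤J g → g ⊗ u ≡ g → u ≤L g
  stability {u} {g} (p , q , u≡pgq) gu≡g = y ^ k ⊗ p , (begin
    u                   ≡⟨ sym eu≡u ⟩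
    (y ⊗ y ^ k) ⊗ u     ≡⟨ cong (_⊗ u) (^-comm y k) ⟩
    (y ^ k ⊗ y) ⊗ u     ≡⟨ ⊗-assoc (y ^ k) y u ⟩
    y ^ k ⊗ (y ⊗ u)     ≡⟨ cong (y ^ k ⊗_) yu≡y ⟩
    y ^ k ⊗ (p ⊗ g)     ≡⟨ sym (⊗-assoc (y ^ k) p g) ⟩
    (y ^ k ⊗ p) ⊗ g     ∎)
    where
    open ≡-Reasoning
    y = p ⊗ g
    yu≡y : y ⊗ u ≡ y
    yu≡y = trans (⊗-assoc p g u) (cong (p ⊗_) gu≡g)
    u≡yuq : u ≡ y ⊗ (u ⊗ q)
    u≡yuq = trans u≡pgq (trans (cong (_⊗ q) (sym yu≡y)) (⊗-assoc y u q))
    iterate : ∀ m → u ≡ y ^ m ⊗ (u ⊗ q ^ m)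
    iterate zero = sym (⊗-identityʳ u)
    iterate (suc m) = begin
      u                                 ≡⟨ iterate m ⟩
      y ^ m ⊗ (u ⊗ q ^ m)               ≡⟨ cong (λ z → y ^ m ⊗ (z ⊗ q ^ m)) u≡yuq ⟩
      y ^ m ⊗ ((y ⊗ (u ⊗ q)) ⊗ q ^ m)   ≡⟨ cong (y ^ m ⊗_) (⊗-assoc y (u ⊗ q) (q ^ m)) ⟩
      y ^ m ⊗ (y ⊗ ((u ⊗ q) ⊗ q ^ m))   ≡⟨ sym (⊗-assoc (y ^ m) y _) ⟩
      (y ^ m ⊗ y) ⊗ ((u ⊗ q) ⊗ q ^ m)   ≡⟨ cong₂ _⊗_ (sym (^-comm y m)) (⊗-assoc u q (q ^ m)) ⟩
      y ^ suc m ⊗ (u ⊗ q ^ suc m)       ∎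
    k = proj₁ (idempotent-power y)
    e = y ^ suc k
    eu≡u : e ⊗ u ≡ u
    eu≡u = begin
      e ⊗ u                       ≡⟨ cong (e ⊗_) (iterate (suc k)) ⟩
      e ⊗ (e ⊗ (u ⊗ q ^ suc k))   ≡⟨ sym (⊗-assoc e e _) ⟩
      (e ⊗ e) ⊗ (u ⊗ q ^ suc k)   ≡⟨ cong (_⊗ (u ⊗ q ^ suc k)) (proj₂ (idempotent-power y)) ⟩
      e ⊗ (u ⊗ q ^ suc k)         ≡⟨ sym (iterate (suc k)) ⟩
      u                           ∎

module _ {A : Set} {_≼_ : A → A → Set} (_≼?_ : ∀ x y → Dec (x ≼ y))
         (≼-trans : ∀ {x y z} → x ≼ y → y ≼ z → x ≼ z) where

  Minimal : A → List A → Set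
  Minimal s xs = ∀ {y} → y ∈ xs → y ≼ s → s ≼ y

  minimal : ∀ x xs → ∃ λ s → s ∈ x ∷ xs × Minimal s (x ∷ xs)
  minimal x [] = x , here refl , λ { (here refl) x≼x → x≼x }
  minimal x (y ∷ ys) with minimal y ys
  ... | m , m∈ , m-min with x ≼? m | m ≼? x
  ... | yes x≼m | no _ = x , here refl , λ
    { (here refl) x≼x → x≼x
    ; (there y∈) y≼x → ≼-trans x≼m (m-min y∈ (≼-trans y≼x x≼m)) }
  ... | yes _ | yes m≼x = m , there m∈ , λ
    { (here refl) _ → m≼x
    ; (there y∈) → m-min y∈ }
  ... | no x⋠m | _ = m , there m∈ , λ
    { (here refl) x≼m → contradiction x≼m x⋠m
    ; (there y∈) → m-min y∈ }

length-filter-split : ∀ {A : Set} {P : A → Set} (P? : ∀ x → Dec (P x)) xs →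
  length (filter P? xs) + length (filter (¬? ∘ P?) xs) ≡ length xs
length-filter-split P? [] = refl
length-filter-split P? (x ∷ xs) with P? x
... | yes _ = cong suc (length-filter-split P? xs)
... | no _ = trans (+-suc _ _) (cong suc (length-filter-split P? xs))

module _ {A : Set} where

  mutual
    Along : {St : Set} → (St → A → St) → (St → A → Set) → St → Tree A → Set
    Along δ Q σ (node cs) = AlongC δ Q σ cs

    AlongC : {St : Set} → (St → A → St) → (St → A → Set) → St → List (A × Tree A) → Set
    AlongC δ Q σ [] = ⊤
    AlongC δ Q σ ((x , t) ∷ cs) = Q σ x × Along δ Q (δ σ x) t × AlongC δ Q σ cs

  module _ {St : Set} {δ : St → A → St} {Q : St → A → Set} (Q-always : ∀ σ x → Q σ x) where
    mutual
      along-always : ∀ σ t → Along δ Q σ t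
      along-always σ (node cs) = along-alwaysC σ cs

      along-alwaysC : ∀ σ cs → AlongC δ Q σ cs
      along-alwaysC σ [] = tt
      along-alwaysC σ ((x , t) ∷ cs) = Q-always σ x , along-always (δ σ x) t , along-alwaysC σ cs

  module _ {St St' : Set} {δ : St → A → St} {δ' : St' → A → St'}
           {Q : St → A → Set} {Q' : St' → A → Set} (R : St → St' → Set)
           (step : ∀ {σ σ' x} → R σ σ' → Q σ x → Q' σ' x × R (δ σ x) (δ' σ' x)) where
    mutual
      along-sim : ∀ {σ σ'} t → R σ σ' → Along δ Q σ t → Along δ' Q' σ' t
      along-sim (node cs) r h = along-simC cs r h

      along-simC : ∀ {σ σ'} cs → R σ σ' → AlongC δ Q σ cs → AlongC δ' Q' σ' cs
      along-simC [] r h = tt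
      along-simC ((x , t) ∷ cs) r (q , h₁ , h₂) =
        let q' , r' = step r q in q' , along-sim t r' h₁ , along-simC cs r h₂

  module _ {St₁ St₂ : Set} {δ₁ : St₁ → A → St₁} {δ₂ : St₂ → A → St₂}
           {Q₁ Q₁' : St₁ → A → Set} {Q₂ : St₂ → A → Set} (R : St₁ → St₂ → Set)
           (step : ∀ {σ₁ σ₂ x} → R σ₁ σ₂ → Q₁ σ₁ x → Q₂ σ₂ x → Q₁' σ₁ x × R (δ₁ σ₁ x) (δ₂ σ₂ x)) where
    mutual
      along-refine : ∀ {σ₁ σ₂} t → R σ₁ σ₂ → Along δ₁ Q₁ σ₁ t → Along δ₂ Q₂ σ₂ t → Along δ₁ Q₁' σ₁ t
      along-refine (node cs) r h₁ h₂ = along-refineC cs r h₁ h₂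

      along-refineC : ∀ {σ₁ σ₂} cs → R σ₁ σ₂ → AlongC δ₁ Q₁ σ₁ cs → AlongC δ₂ Q₂ σ₂ cs →
                      AlongC δ₁ Q₁' σ₁ cs
      along-refineC [] r h₁ h₂ = tt
      along-refineC ((x , t) ∷ cs) r (q₁ , h₁ , g₁) (q₂ , h₂ , g₂) =
        let q' , r' = step r q₁ q₂ in q' , along-refine t r' h₁ h₂ , along-refineC cs r g₁ g₂

  mutual
    data _⊑_ : Tree A → Tree A → Set where
      node : ∀ {cs ds} → cs ⊑C ds → node cs ⊑ node ds

    data _⊑C_ : List (A × Tree A) → List (A × Tree A) → Set where
      done : [] ⊑C []
      skip : ∀ {cs d ds} → cs ⊑C ds → cs ⊑C (d ∷ ds)
      keep : ∀ {x t u cs ds} → t ⊑ u → cs ⊑C ds → ((x , t) ∷ cs) ⊑C ((x , u) ∷ ds)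

  mutual
    along-⊑ : ∀ {St} {δ : St → A → St} {Q : St → A → Set} {σ t u} →
              t ⊑ u → Along δ Q σ u → Along δ Q σ t
    along-⊑ (node p) h = along-⊑C p h

    along-⊑C : ∀ {St} {δ : St → A → St} {Q : St → A → Set} {σ cs ds} →
               cs ⊑C ds → AlongC δ Q σ ds → AlongC δ Q σ cs
    along-⊑C done h = tt
    along-⊑C (skip p) (_ , _ , h) = along-⊑C p h
    along-⊑C (keep p p') (q , h₁ , h₂) = q , along-⊑ p h₁ , along-⊑C p' h₂

  mutual
    rootFactor-⊑ : (P : Tree (A × Bool)) → rootFactor P ⊑ mapT proj₁ P
    rootFactor-⊑ (node cs) = node (rootFactorC-⊑ cs)

    rootFactorC-⊑ : (cs : List ((A × Bool) × Tree (A × Bool))) → rootFactorC cs ⊑C mapC proj₁ cs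
    rootFactorC-⊑ [] = done
    rootFactorC-⊑ (((a , true) , t) ∷ cs) = skip (rootFactorC-⊑ cs)
    rootFactorC-⊑ (((a , false) , t) ∷ cs) = keep (rootFactor-⊑ t) (rootFactorC-⊑ cs)

  heightC-leaves : (L : List (A × Tree A)) → All (λ c → proj₂ c ≡ leaf) L → heightC L ≤ 1
  heightC-leaves [] [] = z≤n
  heightC-leaves ((y , .leaf) ∷ L) (refl ∷ h) = ⊔-lub (s≤s z≤n) (heightC-leaves L h)

  module Cutting {St : Set} (δ : St → A → St) {Cut : St → A → Set}
                 (cut? : ∀ σ x → Dec (Cut σ x)) where
    mutual
      mark : St → Tree A → Tree (A × Bool)
      mark σ (node cs) = node (markC σ cs)

      markC : St → List (A × Tree A) → List ((A × Bool) × Tree (A × Bool))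
      markC σ [] = []
      markC σ ((x , t) ∷ cs) = ((x , does (cut? σ x)) , mark (δ σ x) t) ∷ markC σ cs

    mutual
      erase-mark : ∀ σ t → mapT proj₁ (mark σ t) ≡ t
      erase-mark σ (node cs) = cong node (erase-markC σ cs)

      erase-markC : ∀ σ cs → mapC proj₁ (markC σ cs) ≡ cs
      erase-markC σ [] = refl
      erase-markC σ ((x , t) ∷ cs) =
        cong₂ (λ u us → (x , u) ∷ us) (erase-mark (δ σ x) t) (erase-markC σ cs)

    factorization : St → (t : Tree A) → Factorization t
    factorization σ t = mark σ t , erase-mark σ t

    topFactor : St → Tree A → Tree A
    topFactor σ t = rootFactor (mark σ t)

    topFactor-⊑ : ∀ σ t → topFactor σ t ⊑ t
    topFactor-⊑ σ t = subst (topFactor σ t ⊑_) (erase-mark σ t) (rootFactor-⊑ (mark σ t))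

    module _ {St' : Set} {δ' : St' → A → St'} {Q Q' : St' → A → Set} (Pr : St → St' → Set)
             (step : ∀ {σ τ x} → Pr σ τ → ¬ Cut σ x → Q τ x → Q' τ x × Pr (δ σ x) (δ' τ x)) where
      mutual
        topFactor-along : ∀ σ τ t → Pr σ τ → Along δ' Q τ t → Along δ' Q' τ (topFactor σ t)
        topFactor-along σ τ (node cs) p h = topFactor-alongC σ τ cs p h

        topFactor-alongC : ∀ σ τ cs → Pr σ τ → AlongC δ' Q τ cs →
                           AlongC δ' Q' τ (rootFactorC (markC σ cs))
        topFactor-alongC σ τ [] p h = tt
        topFactor-alongC σ τ ((x , t) ∷ cs) p (q , h₁ , h₂) with cut? σ x
        ... | yes _ = topFactor-alongC σ τ cs p h₂
        ... | no ¬cut = let q' , p' = step p ¬cut q in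
          q' , topFactor-along (δ σ x) (δ' τ x) t p' h₁ , topFactor-alongC σ τ cs p h₂

    module _ (Φ : Tree A → Set) (Inv : St → Tree A → Set) (Top : St → Set)
             (inv-split : ∀ {σ x t cs} → Inv σ (node ((x , t) ∷ cs)) → Inv (δ σ x) t × Inv σ (node cs))
             (cut-top : ∀ {σ x} → Cut σ x → Top (δ σ x))
             (top-factor : ∀ {σ t} → Inv σ t → Top σ → Φ (topFactor σ t)) where
      mutual
        all-factors : ∀ σ t → Inv σ t → Top σ → All Φ (allFactors (mark σ t))
        all-factors σ t inv top = top-factor inv top ∷ inner-factors σ t inv

        inner-factors : ∀ σ t → Inv σ t → All Φ (innerFactors (mark σ t))
        inner-factors σ (node cs) inv = inner-factorsC σ cs inv

        inner-factorsC : ∀ σ cs → Inv σ (node cs) → All Φ (innerFactorsC (markC σ cs))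
        inner-factorsC σ [] inv = []
        inner-factorsC σ ((x , t) ∷ cs) inv with inv-split inv | cut? σ x
        ... | inv-t , inv-cs | yes cut =
          AllP.++⁺ (all-factors (δ σ x) t inv-t (cut-top cut)) (inner-factorsC σ cs inv-cs)
        ... | inv-t , inv-cs | no _ =
          AllP.++⁺ (inner-factors (δ σ x) t inv-t) (inner-factorsC σ cs inv-cs)

    module _ (_∙_ : A → A → A) where
      _⋆_ : Maybe A → A → A
      nothing ⋆ x = x
      just r ⋆ x = r ∙ x

      module _ (assoc : ∀ x y z → (x ∙ y) ∙ z ≡ x ∙ (y ∙ z))
               (Lab : A → Set) (Pending : St → Maybe A → Set)
               (at-cut : ∀ {σ r x} → Pending σ r → Cut σ x → Lab (r ⋆ x) × Pending (δ σ x) nothing)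
               (past-uncut : ∀ {σ r x} → Pending σ r → ¬ Cut σ x → Pending (δ σ x) (just (r ⋆ x)))
               where
        ⋆-assoc : ∀ r x y → (r ⋆ x) ∙ y ≡ r ⋆ (x ∙ y)
        ⋆-assoc nothing x y = refl
        ⋆-assoc (just r) x y = assoc r x y

        Labelled : Maybe A → A × Tree A → Set
        Labelled r (y , u) = Lab (r ⋆ y) × All Lab (labels u)

        labelsC-all : ∀ L → All (Labelled nothing) L → All Lab (labelsC L)
        labelsC-all [] [] = []
        labelsC-all ((y , u) ∷ L) ((lab-y , lab-u) ∷ h) = lab-y ∷ AllP.++⁺ lab-u (labelsC-all L h)

        quotC-labelled : ∀ σ r cs → Pending σ r → All (Labelled r) (quotC _∙_ (markC σ cs))
        quotC-labelled σ r [] pend = []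
        quotC-labelled σ r ((x , node ds) ∷ cs) pend with cut? σ x
        ... | yes cut = let lab , pend' = at-cut pend cut in
          (lab , labelsC-all _ (quotC-labelled (δ σ x) nothing ds pend'))
          ∷ quotC-labelled σ r cs pend
        ... | no ¬cut = AllP.++⁺
          (AllP.map⁺ (All.map (λ { {y , u} (lab , lab-u) → subst Lab (⋆-assoc r x y) lab , lab-u })
                             (quotC-labelled (δ σ x) (just (r ⋆ x)) ds (past-uncut pend ¬cut))))
          (quotC-labelled σ r cs pend)

        quotient-labels : ∀ σ t → Pending σ nothing → All Lab (labels (quotT _∙_ (mark σ t)))
        quotient-labels σ (node cs) pend = labelsC-all _ (quotC-labelled σ nothing cs pend)

      -- The quotient is shallow if no edge is cut below a cut edge: a state reached
      -- through a cut is Sealed, and Sealed states forbid cuts and persist.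
      module _ (Sealed : St → Set)
               (cut-seals : ∀ {σ x} → Cut σ x → Sealed (δ σ x))
               (sealed-no-cut : ∀ {σ x} → Sealed σ → ¬ Cut σ x)
               (sealed-stays : ∀ {σ x} → Sealed σ → Sealed (δ σ x)) where
        quotC-sealed : ∀ {σ} cs → Sealed σ → quotC _∙_ (markC σ cs) ≡ []
        quotC-sealed [] sealed = refl
        quotC-sealed {σ} ((x , node ds) ∷ cs) sealed with cut? σ x
        ... | yes cut = contradiction cut (sealed-no-cut sealed)
        ... | no _ rewrite quotC-sealed ds (sealed-stays {x = x} sealed) | quotC-sealed cs sealed = refl

        quotC-leaves : ∀ σ cs → All (λ c → proj₂ c ≡ leaf) (quotC _∙_ (markC σ cs))
        quotC-leaves σ [] = []
        quotC-leaves σ ((x , node ds) ∷ cs) with cut? σ x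
        ... | yes cut = cong node (quotC-sealed ds (cut-seals cut)) ∷ quotC-leaves σ cs
        ... | no _ = AllP.++⁺ (AllP.map⁺ (quotC-leaves (δ σ x) ds)) (quotC-leaves σ cs)

        quotient-shallow : ∀ σ t → Shallow (quotT _∙_ (mark σ t))
        quotient-shallow σ (node cs) = ≤-trans (heightC-leaves _ (quotC-leaves σ cs)) (s≤s z≤n)

module Hierarchy {n : ℕ} (S : FinSemigroup n) where
  open FinSemigroup S

  Decomposes : (Tree (Fin n) → Set) → Tree (Fin n) → Set
  Decomposes Φ T = ∃ λ (P : Factorization T) →
    All Φ (factors P) × (Splendid S (quotient S P) ⊎ Shallow (quotient S P))

  H : ℕ → Tree (Fin n) → Set
  H zero T = T ≡ leaf
  H (suc i) T = H i T ⊎ Decomposes (H i) T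

  H-mono : ∀ k {i T} → H i T → H (k + i) T
  H-mono zero h = h
  H-mono (suc k) h = inj₁ (H-mono k h)

  module Uncut = Cutting {A = Fin n} {St = ⊤} (λ _ _ → tt) {Cut = λ _ _ → ⊥} (λ _ _ → no λ ())

  mutual
    uncut-top : ∀ t → Uncut.topFactor tt t ≡ t
    uncut-top (node cs) = cong node (uncut-topC cs)

    uncut-topC : ∀ cs → rootFactorC (Uncut.markC tt cs) ≡ cs
    uncut-topC [] = refl
    uncut-topC ((x , t) ∷ cs) = cong₂ (λ u us → (x , u) ∷ us) (uncut-top t) (uncut-topC cs)

  mutual
    uncut-inner : ∀ t → innerFactors (Uncut.mark tt t) ≡ []
    uncut-inner (node cs) = uncut-innerC cs

    uncut-innerC : ∀ cs → innerFactorsC (Uncut.markC tt cs) ≡ []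
    uncut-innerC [] = refl
    uncut-innerC ((x , t) ∷ cs) rewrite uncut-inner t | uncut-innerC cs = refl

  decomposes-trivially : ∀ {Φ T} → Φ T → Decomposes Φ T
  decomposes-trivially {Φ} {T} φ = Uncut.factorization tt T , single ,
    inj₂ (Uncut.quotient-shallow _·_ (λ _ → ⊤) (λ ()) (λ _ ()) (λ _ → tt) tt T)
    where
    single : All Φ (Uncut.topFactor tt T ∷ innerFactors (Uncut.mark tt T))
    single rewrite uncut-top T | uncut-inner T = φ ∷ []

  H-decomposes : ∀ i T → H (suc i) T → Decomposes (H i) T
  H-decomposes i T (inj₁ h) = decomposes-trivially h
  H-decomposes i T (inj₂ d) = d

module Infixes {n : ℕ} (S : FinSemigroup n) where
  open FinSemigroup S
  open Monoid¹ S
  open Hierarchy S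

  -- Below an edge labelled x, the products of the vertical paths ending at the new node
  -- are x and the products L of those ending at the parent, extended by x.
  extendInfixes : List S¹ → Fin n → List S¹
  extendInfixes L x = just x ∷ map (_⊗ just x) L

  InfixesIn : List S¹ → List S¹ → Fin n → Set
  InfixesIn X L x = All (_∈ X) (extendInfixes L x)

  AllInfixesIn : List S¹ → Tree (Fin n) → Set
  AllInfixesIn X W = Along extendInfixes (InfixesIn X) [] W

  infixes-weaken : ∀ {X L L'} t → L' ⊆ L →
    Along extendInfixes (InfixesIn X) L t → Along extendInfixes (InfixesIn X) L' t
  infixes-weaken t = along-sim (λ L L' → L' ⊆ L) step t
    where
    extend-⊆ : ∀ {L L'} x → L' ⊆ L → extendInfixes L' x ⊆ extendInfixes L x
    extend-⊆ x L'⊆L (here refl) = here refl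
    extend-⊆ x L'⊆L (there y∈) with ∈-map⁻ (_⊗ just x) y∈
    ... | z , z∈ , refl = there (∈-map⁺ (_⊗ just x) (L'⊆L z∈))

    step : ∀ {L L' x} → L' ⊆ L → InfixesIn _ L x → InfixesIn _ L' x ×
           (extendInfixes L' x ⊆ extendInfixes L x)
    step {x = x} L'⊆L in-X = tabulate (lookup in-X ∘ extend-⊆ x L'⊆L) , extend-⊆ x L'⊆L

  no-infixes : ∀ W → AllInfixesIn [] W → W ≡ leaf
  no-infixes (node []) _ = refl
  no-infixes (node ((x , t) ∷ cs)) ((() ∷ _) , _)

  all-infixes : ∀ W → AllInfixesIn (map just (allFin n)) W
  all-infixes = along-always (λ L x → tabulate (in-S L x)) []
    where
    in-S : ∀ L x {y} → y ∈ extendInfixes L x → y ∈ map just (allFin n)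
    in-S L x (here refl) = ∈-map⁺ just (∈-allFin x)
    in-S L x (there y∈) with ∈-map⁻ (_⊗ just x) y∈
    ... | nothing , _ , refl = ∈-map⁺ just (∈-allFin x)
    ... | just z , _ , refl = ∈-map⁺ just (∈-allFin (z · x))

  -- Everything relative to a fixed s ∈ S¹; the minimality of s in X enters only
  -- through the hypothesis of `peel`.
  module Around (X : List S¹) (s : S¹) where
    Low : S¹ → Set
    Low u = u ≤J s

    low? : ∀ u → Dec (Low u)
    low? u = u ≤J? s

    -- A frame (a , b) records the product a since the last low node and the product b
    -- from the top of the tree; a node is low when its a-product would be ≤J s.
    Frame : Set
    Frame = S¹ × S¹

    next : Frame → Fin n → Frame
    next (a , b) x = (if does (low? (a ⊗ just x)) then nothing else a ⊗ just x) , b ⊗ just x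

    LowIn : List S¹ → Frame → Fin n → Set
    LowIn K (a , b) x = Low (a ⊗ just x) → b ⊗ just x ∈ K

    record Good (K : List S¹) (σ : Frame) (W : Tree (Fin n)) : Set where
      constructor good
      field
        infixes : AllInfixesIn X W
        lows : Along next (LowIn K) σ W

    good-split : ∀ {K σ x t cs} → Good K σ (node ((x , t) ∷ cs)) → Good K (next σ x) t × Good K σ (node cs)
    good-split {t = t} (good (_ , in-t , in-cs) (_ , low-t , low-cs)) =
      good (infixes-weaken t (λ ()) in-t) low-t , good in-cs low-cs

    good-⊑ : ∀ {K σ t u} → t ⊑ u → Good K σ u → Good K σ t
    good-⊑ t⊑u (good in-X low) = good (along-⊑ t⊑u in-X) (along-⊑ t⊑u low)

    Above Below : List S¹
    Above = filter (¬? ∘ low?) X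
    Below = filter low? X

    -- At the top, every low node has its product from the top in Below: that product is
    -- an infix and lies L-below the a-product.
    initially-good : ∀ W → AllInfixesIn X W → Along next (LowIn Below) (nothing , nothing) W
    initially-good W = along-sim Prefix step W (inj₁ refl , ≤L-refl nothing)
      where
      Prefix : List S¹ → Frame → Set
      Prefix L (a , b) = (b ≡ nothing ⊎ b ∈ L) × b ≤L a

      prefix-infix : ∀ {L b} x → (b ≡ nothing ⊎ b ∈ L) → b ⊗ just x ∈ extendInfixes L x
      prefix-infix x (inj₁ refl) = here refl
      prefix-infix x (inj₂ b∈) = there (∈-map⁺ (_⊗ just x) b∈)

      step : ∀ {L σ x} → Prefix L σ → InfixesIn X L x → LowIn Below σ x × Prefix (extendInfixes L x) (next σ x)
      step {L} {a , b} {x} (b-infix , b≤a) in-X = low-in , inj₂ (prefix-infix x b-infix) , b≤a'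
        where
        low-in : LowIn Below (a , b) x
        low-in low = ∈-filter⁺ low? (lookup in-X (prefix-infix x b-infix))
                       (≤J-trans (≤L⇒≤J (≤L-⊗ʳ (just x) b≤a)) low)
        b≤a' : (b ⊗ just x) ≤L proj₁ (next (a , b) x)
        b≤a' with low? (a ⊗ just x)
        ... | yes _ = ≤L-one _
        ... | no _ = ≤L-⊗ʳ (just x) b≤a

    -- Without low nodes the a-product is never reset, so it lies L-below every infix;
    -- hence no infix is below s.
    no-low-infixes-above : ∀ σ W → AllInfixesIn X W → Along next (LowIn []) σ W → AllInfixesIn Above W
    no-low-infixes-above (a₀ , b₀) W = along-refine Suffix step W (λ ())
      where
      Suffix : List S¹ → Frame → Set
      Suffix L (a , b) = ∀ {y} → y ∈ L → a ≤L y

      step : ∀ {L σ x} → Suffix L σ → InfixesIn X L x → LowIn [] σ x →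
             InfixesIn Above L x × Suffix (extendInfixes L x) (next σ x)
      step {L} {a , b} {x} a≤L in-X no-low with low? (a ⊗ just x)
      ... | yes low = contradiction (no-low low) λ ()
      ... | no ¬low = tabulate above , a≤L'
        where
        a≤L' : Suffix (extendInfixes L x) (a ⊗ just x , b ⊗ just x)
        a≤L' (here refl) = a , refl
        a≤L' (there y∈) with ∈-map⁻ (_⊗ just x) y∈
        ... | z , z∈ , refl = ≤L-⊗ʳ (just x) (a≤L z∈)
        above : ∀ {y} → y ∈ extendInfixes L x → y ∈ Above
        above y∈ = ∈-filter⁺ (¬? ∘ low?) (lookup in-X y∈)
                     λ low-y → ¬low (≤J-trans (≤L⇒≤J (a≤L' y∈)) low-y)

    -- One value g ∈ K at a time: a tree that is Good for g ∷ K lies three levels above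
    -- the level l reached by the trees that are Good for K.
    module Layers (g : S¹) (K : List S¹) (s≤g : s ≤J g) (l : ℕ)
                  (IH : ∀ σ W → Good K σ W → H l W) where
      GNode : Frame → Fin n → Set
      GNode (a , b) x = Low (a ⊗ just x) × b ⊗ just x ≡ g

      gnode? : ∀ σ x → Dec (GNode σ x)
      gnode? (a , b) x = low? (a ⊗ just x) ×-dec (b ⊗ just x ≟ g)

      gnode-next : ∀ {σ x} → GNode σ x → next σ x ≡ (nothing , g)
      gnode-next {a , b} {x} (low , bx≡g) with low? (a ⊗ just x)
      ... | yes _ = cong (nothing ,_) bx≡g
      ... | no ¬low = contradiction low ¬low

      lowIn-drop : ∀ {σ x} → ¬ GNode σ x → LowIn (g ∷ K) σ x → LowIn K σ x
      lowIn-drop ¬gnode low-in low with low-in low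
      ... | here bx≡g = contradiction (low , bx≡g) ¬gnode
      ... | there bx∈K = bx∈K

      module Every = Cutting next gnode?

      _⋆_ : S¹ → Fin n → Fin n
      _⋆_ = Every._⋆_ _·_

      ⋆-just : ∀ r x → just (r ⋆ x) ≡ r ⊗ just x
      ⋆-just nothing x = refl
      ⋆-just (just r) x = refl

      -- label of a quotient edge between g-nodes: it fixes g and is L-below g
      Absorbed : Fin n → Set
      Absorbed ℓ = g ⊗ just ℓ ≡ g × just ℓ ≤L g

      absorbed-ramsey : ∀ L → All Absorbed L → ForwardRamsey S L
      absorbed-ramsey L absorbed e f e∈ f∈ with lookup absorbed e∈ | lookup absorbed f∈
      ... | _ , t , e≡tg | gf≡g , _ = just-injective (begin
        just e ⊗ just f   ≡⟨ cong (_⊗ just f) e≡tg ⟩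
        (t ⊗ g) ⊗ just f  ≡⟨ ⊗-assoc t g (just f) ⟩
        t ⊗ (g ⊗ just f)  ≡⟨ cong (t ⊗_) gf≡g ⟩
        t ⊗ g             ≡⟨ sym e≡tg ⟩
        just e            ∎)
        where open ≡-Reasoning

      -- the product r since the last g-node: b = g·r and r is L-below a
      Pending : Frame → Maybe (Fin n) → Set
      Pending (a , b) r = b ≡ g ⊗ r × r ≤L a

      pending-cut : ∀ {σ r x} → Pending σ r → GNode σ x →
                    Absorbed (r ⋆ x) × Pending (next σ x) nothing
      pending-cut {a , b} {r} {x} (b≡gr , r≤a) gnode@(low , bx≡g) =
        (fixes , stability below-g fixes) ,
        subst (λ σ → Pending σ nothing) (sym (gnode-next gnode)) (sym (⊗-identityʳ g) , ≤L-refl nothing)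
        where
        fixes : g ⊗ just (r ⋆ x) ≡ g
        fixes = begin
          g ⊗ just (r ⋆ x) ≡⟨ cong (g ⊗_) (⋆-just r x) ⟩
          g ⊗ (r ⊗ just x)       ≡⟨ sym (⊗-assoc g r (just x)) ⟩
          (g ⊗ r) ⊗ just x       ≡⟨ cong (_⊗ just x) (sym b≡gr) ⟩
          b ⊗ just x             ≡⟨ bx≡g ⟩
          g                      ∎
          where open ≡-Reasoning
        below-g : just (r ⋆ x) ≤J g
        below-g = ≤J-trans (≤L⇒≤J (subst (_≤L (a ⊗ just x)) (sym (⋆-just r x)) (≤L-⊗ʳ (just x) r≤a)))
                           (≤J-trans low s≤g)

      pending-past : ∀ {σ r x} → Pending σ r → ¬ GNode σ x → Pending (next σ x) (just (r ⋆ x))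
      pending-past {a , b} {r} {x} (b≡gr , r≤a) _ = b' , r≤a'
        where
        b' : b ⊗ just x ≡ g ⊗ just (r ⋆ x)
        b' = trans (cong (_⊗ just x) b≡gr) (trans (⊗-assoc g r (just x)) (cong (g ⊗_) (sym (⋆-just r x))))
        r≤a' : just (r ⋆ x) ≤L proj₁ (next (a , b) x)
        r≤a' rewrite ⋆-just r x with low? (a ⊗ just x)
        ... | yes _ = ≤L-one _
        ... | no _ = ≤L-⊗ʳ (just x) r≤a

      every-factor-good : ∀ {σ t} → Good (g ∷ K) σ t → Good K σ (Every.topFactor σ t)
      every-factor-good {σ} {t} (good in-X low-in) = good (along-⊑ (Every.topFactor-⊑ σ t) in-X)
        (Every.topFactor-along (λ σ τ → τ ≡ σ) (λ { refl ¬gnode q → lowIn-drop ¬gnode q , refl })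
                               σ σ t refl low-in)

      -- U hangs below a g-node; its factors lie in H_l ⊆ H_{l+1} (one level of slack)
      splendid-layer : ∀ U → Good (g ∷ K) (nothing , g) U → H (2 + l) U
      splendid-layer U U-good = inj₂ (Every.factorization (nothing , g) U ,
        Every.all-factors (H (suc l)) (Good (g ∷ K)) (λ _ → ⊤) good-split (λ _ → tt)
          (λ t-good _ → inj₁ (IH _ _ (every-factor-good t-good))) (nothing , g) U U-good tt ,
        inj₁ (absorbed-ramsey _ (Every.quotient-labels _·_ assoc Absorbed Pending pending-cut pending-past
                                    (nothing , g) U (sym (⊗-identityʳ g) , ≤L-refl nothing))))

      -- Shallow layer: cut only at the topmost g-nodes; the flag records whether a g-node
      -- has been passed.
      nextFirst : Frame × Bool → Fin n → Frame × Bool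
      nextFirst (σ , passed) x = next σ x , passed ∨ does (gnode? σ x)

      FirstG : Frame × Bool → Fin n → Set
      FirstG (σ , passed) x = passed ≡ false × GNode σ x

      firstG? : ∀ σp x → Dec (FirstG σp x)
      firstG? (σ , passed) x = (passed ≟ᵇ false) ×-dec gnode? σ x

      module First = Cutting nextFirst firstG?

      FactorTop : Frame × Bool → Set
      FactorTop (σ , passed) = passed ≡ false ⊎ σ ≡ (nothing , g)

      Passed : Frame × Bool → Set
      Passed (_ , passed) = passed ≡ true

      first-passes : ∀ {σp x} → FirstG σp x → Passed (nextFirst σp x)
      first-passes {σ , .false} {x} (refl , gnode) = dec-true (gnode? σ x) gnode

      first-root-good : ∀ {σ t} → Good (g ∷ K) σ t → Good K σ (First.topFactor (σ , false) t)
      first-root-good {σ} {t} (good in-X low-in) = good (along-⊑ (First.topFactor-⊑ (σ , false) t) in-X)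
        (First.topFactor-along (λ σp τ → σp ≡ (τ , false)) step (σ , false) σ t refl low-in)
        where
        step : ∀ {σp τ x} → σp ≡ (τ , false) → ¬ FirstG σp x → LowIn (g ∷ K) τ x →
               LowIn K τ x × nextFirst σp x ≡ (next τ x , false)
        step {τ = τ} {x} refl ¬first low-in =
          lowIn-drop ¬gnode low-in , cong (next τ x ,_) (dec-false (gnode? τ x) ¬gnode)
          where
          ¬gnode : ¬ GNode τ x
          ¬gnode gnode = ¬first (refl , gnode)

      -- the root factor lies in H_l, the other factors in H_{2+l} by the splendid layer
      shallow-layer : ∀ σ W → Good (g ∷ K) σ W → H (3 + l) W
      shallow-layer σ W W-good = inj₂ (First.factorization (σ , false) W ,
        First.all-factors (H (2 + l)) (Good (g ∷ K) ∘ proj₁) FactorTop good-split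
          (λ first → inj₂ (gnode-next (proj₂ first))) factor (σ , false) W W-good (inj₁ refl) ,
        inj₂ (First.quotient-shallow _·_ Passed first-passes (λ { refl (() , _) }) (λ { refl → refl })
                                     (σ , false) W))
        where
        factor : ∀ {σp t} → Good (g ∷ K) (proj₁ σp) t → FactorTop σp → H (2 + l) (First.topFactor σp t)
        factor {σ , .false} t-good (inj₁ refl) = H-mono 2 (IH σ _ (first-root-good t-good))
        factor {.(nothing , g) , _} {t} t-good (inj₂ refl) =
          splendid-layer _ (good-⊑ (First.topFactor-⊑ _ t) t-good)

    peel : ∀ m → (∀ W → AllInfixesIn Above W → H m W) →
           ∀ K → (∀ {k} → k ∈ K → s ≤J k) → ∀ σ W → Good K σ W → H (m + 3 * length K) W
    peel m IH [] _ σ W (good in-X no-low) =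
      subst (λ j → H j W) (sym (+-identityʳ m)) (IH W (no-low-infixes-above σ W in-X no-low))
    peel m IH (g ∷ K) above-s σ W W-good = subst (λ j → H j W) (three-more (length K))
      (Layers.shallow-layer g K (above-s (here refl)) _ (peel m IH K (above-s ∘ there)) σ W W-good)
      where
      three-more : ∀ k → 3 + (m + 3 * k) ≡ m + 3 * suc k
      three-more k = sym (begin
        m + 3 * suc k         ≡⟨ cong (m +_) (*-suc 3 k) ⟩
        m + (3 + 3 * k)       ≡⟨ sym (+-assoc m 3 (3 * k)) ⟩
        m + 3 + 3 * k         ≡⟨ cong (_+ 3 * k) (+-comm m 3) ⟩
        3 + m + 3 * k         ≡⟨ +-assoc 3 m (3 * k) ⟩
        3 + (m + 3 * k)       ∎)
        where open ≡-Reasoning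

  infixes-level : ∀ k X → length X ≤ k → ∀ W → AllInfixesIn X W → H (3 * length X) W
  infixes-level k [] _ W in-X = no-infixes W in-X
  infixes-level (suc k) X@(x ∷ xs) (s≤s |xs|≤k) W in-X =
    subst (λ j → H j W) sizes
      (peel (3 * length Above) (infixes-level k Above |Above|≤k) Below below-above
            (nothing , nothing) W (good in-X (initially-good W in-X)))
    where
    min = minimal _≤J?_ ≤J-trans x xs
    s = proj₁ min
    open Around X s

    |Above|<|X| : length Above < length X
    |Above|<|X| = filter-notAll (¬? ∘ low?) X (lose (proj₁ (proj₂ min)) λ ¬low → ¬low (≤J-refl s))

    |Above|≤k : length Above ≤ k
    |Above|≤k = ≤-pred (≤-trans |Above|<|X| (s≤s |xs|≤k))

    -- by minimality of s, the values below s are J-equivalent to it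
    below-above : ∀ {k} → k ∈ Below → s ≤J k
    below-above k∈ = let k∈X , low = ∈-filter⁻ low? k∈ in proj₂ (proj₂ min) k∈X low

    sizes : 3 * length Above + 3 * length Below ≡ 3 * length X
    sizes = trans (sym (*-distribˡ-+ 3 (length Above) (length Below)))
              (cong (3 *_) (trans (+-comm (length Above) (length Below)) (length-filter-split low? X)))

  every-tree : ∀ T → H (3 * n) T
  every-tree T = subst (λ m → H (3 * m) T) |S|≡n
    (infixes-level n (map just (allFin n)) (≤-reflexive |S|≡n) T (all-infixes T))
    where
    |S|≡n : length (map just (allFin n)) ≡ n
    |S|≡n = trans (length-map just (allFin n)) (length-tabulate (λ i → i))

lemma3p6 : (n : ℕ) (S : FinSemigroup n) →
    Σ (ℕ → Tree (Fin n) → Set) (λ H →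
      (∀ T → H 0 T ⇔ (T ≡ leaf))
      × (∀ T → H (3 * n) T)
      × (∀ i T → i < 3 * n → H i T → H (suc i) T)
      × (∀ i T → i < 3 * n → H (suc i) T →
           ∃ (λ (P : Factorization T) →
             All (H i) (factors P)
             × (Splendid S (quotient S P) ⊎ Shallow (quotient S P)))))
lemma3p6 n S =
  H , (λ T → mk⇔ (λ h → h) (λ h → h)) , Infixes.every-tree S ,
  (λ i T _ → H-mono 1) , (λ i T _ → H-decomposes i T)
  where open Hierarchy S
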